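{- For every $k\in\mathbb{N}$ and every $M\models T_{\mathrm{MSO(Fin)}}$ there is $n\in\mathbb{N}$ such that $M\approx_k\mathrm{MSO}(n)$.
   Context: $\mathbb{N}=\{0,1,2,\dots\}$. Let $\mathcal{L}=\{\subseteq,\bot,\mathrm{At},\lhd\}$ be the first-order language with binary relation symbols $\subseteq,\lhd$, a constant $\bot$ and a unary relation symbol $\mathrm{At}$. For a linear order $(\alpha,<)$, $\mathrm{MSO}(\alpha)$ is the $\mathcal{L}$-structure with universe $\mathcal{P}(\alpha)$, $\subseteq$ inclusion, $\bot=\emptyset$, $\mathrm{At}$ the singletons, $A\lhd B$ iff some $a\in A$, $b\in B$ have $a<b$; $\mathrm{MSO}(n)$ is this for the $n$-element order. Lowercase variables range over atoms; $X(x)$ abbreviates $x\subseteq X$. $T_{\mathrm{base}}$ states: $\subseteq$ is an atomic Boolean algebra order (one-element algebra allowed); $\lhd$ linearly orders the atoms; $\bot$ is least; $\mathrm{At}$ holds exactly of atoms; $\forall X\forall Y(X\lhd Y\leftrightarrow\exists x\exists y(X(x)\wedge Y(y)\wedge x\lhd y))$; and for every $\mathcal{L}$-formula $\eta(x;\bar Y)$, $\forall\bar Y\exists X\forall x(X(x)\leftrightarrow\eta(x;\bar Y))$. $T_{\mathrm{MSO(Fin)}}$ is $T_{\mathrm{base}}$ plus: the order on atoms is discrete with endpoints, and every $X\neq\bot$ contains a $\lhd$-least atom. $M\approx_k N$ means $M,N$ satisfy the same unnested $\mathcal{L}$-sentences of quantifier rank at most $k$ (unnested: all atomic subformulas are $x=y$,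 $x=\bot$, $\mathrm{At}(x)$, $x\subseteq y$, $x\lhd y$ with $x,y$ variables), equivalently player II wins the $k$-round unnested Ehrenfeucht–Fraïssé game on $M,N$. -}

module Defs where

open import Level using (0ℓ)
open import Data.Nat using (ℕ; zero; suc; _⊔_)
open import Data.Fin using (Fin)
import Data.Fin as F
open import Data.Fin.Subset using (Subset; _∈_; ⁅_⁆)
import Data.Fin.Subset as Sub
open import Data.Product using (Σ; ∃; ∃-syntax; _×_; _,_)
open import Data.Sum using (_⊎_)
open import Data.Empty using (⊥)
open import Relation.Nullary using (¬_)
open import Relation.Binary.PropositionalEquality using (_≡_; _≢_)
open import Algebra.Lattice.Structures using (IsBooleanAlgebra)

infixr 2 _⇔_
_⇔_ : Set → Set → Set
A ⇔ B = (A → B) × (B → A)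

record Structure : Set₁ where
  field
    Carrier : Set
    _⊆ₛ_    : Carrier → Carrier → Set
    botₛ    : Carrier
    Atₛ     : Carrier → Set
    _⊲ₛ_    : Carrier → Carrier → Set

data Term (n : ℕ) : Set where
  var  : Fin n → Term n
  botT : Term n

data Formula (n : ℕ) : Set where
  _≐_  : Term n → Term n → Formula n
  _⊆'_ : Term n → Term n → Formula n
  _⊲'_ : Term n → Term n → Formula n
  At'  : Term n → Formula n
  ¬'_  : Formula n → Formula n
  _∧'_ : Formula n → Formula n → Formula n
  _∨'_ : Formula n → Formula n → Formula n
  _⇒'_ : Formula n → Formula n → Formula n
  ∀'   : Formula (suc n) → Formula n
  ∃'   : Formula (suc n) → Formula n

Sentence : Set
Sentence = Formula zero

qr : ∀ {n} → Formula n → ℕ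
qr (t ≐ u)   = zero
qr (t ⊆' u)  = zero
qr (t ⊲' u)  = zero
qr (At' t)   = zero
qr (¬' φ)    = qr φ
qr (φ ∧' ψ)  = qr φ ⊔ qr ψ
qr (φ ∨' ψ)  = qr φ ⊔ qr ψ
qr (φ ⇒' ψ)  = qr φ ⊔ qr ψ
qr (∀' φ)    = suc (qr φ)
qr (∃' φ)    = suc (qr φ)

data Unnested {n : ℕ} : Formula n → Set where
  u-eq   : ∀ i j → Unnested (var i ≐ var j)
  u-eqbot : ∀ i → Unnested (var i ≐ botT)
  u-at   : ∀ i → Unnested (At' (var i))
  u-sub  : ∀ i j → Unnested (var i ⊆' var j)
  u-lt   : ∀ i j → Unnested (var i ⊲' var j)
  u-not  : ∀ {φ} → Unnested φ → Unnested (¬' φ)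
  u-and  : ∀ {φ ψ} → Unnested φ → Unnested ψ → Unnested (φ ∧' ψ)
  u-or   : ∀ {φ ψ} → Unnested φ → Unnested ψ → Unnested (φ ∨' ψ)
  u-imp  : ∀ {φ ψ} → Unnested φ → Unnested ψ → Unnested (φ ⇒' ψ)
  u-all  : ∀ {φ} → Unnested φ → Unnested (∀' φ)
  u-ex   : ∀ {φ} → Unnested φ → Unnested (∃' φ)

module _ (M : Structure) where
  open Structure M

  Env : ℕ → Set
  Env n = Fin n → Carrier

  extend : ∀ {n} → Carrier → Env n → Env (suc n)
  extend a ρ F.zero    = a
  extend a ρ (F.suc i) = ρ i

  evalT : ∀ {n} → Env n → Term n → Carrier
  evalT ρ (var i) = ρ i
  evalT ρ botT    = botₛ

  Sat : ∀ {n} → Env n → Formula n → Set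
  Sat ρ (t ≐ u)  = evalT ρ t ≡ evalT ρ u
  Sat ρ (t ⊆' u) = evalT ρ t ⊆ₛ evalT ρ u
  Sat ρ (t ⊲' u) = evalT ρ t ⊲ₛ evalT ρ u
  Sat ρ (At' t)  = Atₛ (evalT ρ t)
  Sat ρ (¬' φ)   = ¬ Sat ρ φ
  Sat ρ (φ ∧' ψ) = Sat ρ φ × Sat ρ ψ
  Sat ρ (φ ∨' ψ) = Sat ρ φ ⊎ Sat ρ ψ
  Sat ρ (φ ⇒' ψ) = Sat ρ φ → Sat ρ ψ
  Sat ρ (∀' φ)   = (a : Carrier) → Sat (extend a ρ) φ
  Sat ρ (∃' φ)   = Σ Carrier λ a → Sat (extend a ρ) φ

  noVars : Env zero
  noVars ()

  _⊨_ : Sentence → Set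
  _⊨_ φ = Sat noVars φ

_≈[_]_ : Structure → ℕ → Structure → Set
M ≈[ k ] N = (φ : Sentence) → Unnested φ → qr φ Data.Nat.≤ k → (M ⊨ φ) ⇔ (N ⊨ φ)

MSO : ℕ → Structure
MSO n = record
  { Carrier = Subset n
  ; _⊆ₛ_    = Sub._⊆_
  ; botₛ    = Sub.⊥
  ; Atₛ     = λ A → ∃[ i ] (A ≡ ⁅ i ⁆)
  ; _⊲ₛ_    = λ A B → ∃[ a ] ∃[ b ] (a ∈ A × b ∈ B × a F.< b)
  }

-- The theories T_base and T_MSO(Fin), written out semantically
-- (each clause is the literal meaning of the corresponding axiom/schema)

module _ (M : Structure) where
  open Structure M

  IsAtom : Carrier → Set
  IsAtom a = (a ≢ botₛ) × (∀ y → y ⊆ₛ a → (y ≡ botₛ) ⊎ (y ≡ a))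

  record ModelsTbase : Set where
    field
      -- ⊆ is an atomic Boolean algebra order (one-element algebra allowed),
      -- with ⊥ its least element
      boolean : Σ (Carrier → Carrier → Carrier) λ _∨_ →
                Σ (Carrier → Carrier → Carrier) λ _∧_ →
                Σ (Carrier → Carrier) λ ∁ →
                Σ Carrier λ ⊤ →
                  IsBooleanAlgebra _≡_ _∨_ _∧_ ∁ ⊤ botₛ
                  × (∀ x y → x ⊆ₛ y ⇔ (x ∧ y) ≡ x)
      bot-least : ∀ x → botₛ ⊆ₛ x
      atomic    : ∀ x → x ≢ botₛ → ∃[ a ] (IsAtom a × a ⊆ₛ x)
      At-atoms  : ∀ x → Atₛ x ⇔ IsAtom x
      ⊲-irrefl  : ∀ x → Atₛ x → ¬ (x ⊲ₛ x)
      ⊲-trans   : ∀ x y z → Atₛ x → Atₛ y → Atₛ z → x ⊲ₛ y → y ⊲ₛ z → x ⊲ₛ z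
      ⊲-total   : ∀ x y → Atₛ x → Atₛ y → (x ⊲ₛ y) ⊎ (x ≡ y) ⊎ (y ⊲ₛ x)
      ⊲-ext     : ∀ X Y → X ⊲ₛ Y ⇔
                    (∃[ x ] ∃[ y ] (Atₛ x × Atₛ y × x ⊆ₛ X × y ⊆ₛ Y × x ⊲ₛ y))
      comprehension : ∀ m (η : Formula (suc m)) (ρ : Env M m) →
                      ∃[ X ] (∀ x → Atₛ x → (x ⊆ₛ X ⇔ Sat M (extend M x ρ) η))

  record ModelsTMSOFin : Set where
    field
      base : ModelsTbase
      endpoints : (∃[ a ] Atₛ a) →
                  (∃[ a ] (Atₛ a × ∀ b → Atₛ b → (a ≡ b) ⊎ (a ⊲ₛ b)))
                  × (∃[ a ] (Atₛ a × ∀ b → Atₛ b → (b ≡ a) ⊎ (b ⊲ₛ a)))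
      succ : ∀ a → Atₛ a → (∃[ b ] (Atₛ b × a ⊲ₛ b)) →
             ∃[ b ] (Atₛ b × a ⊲ₛ b × ∀ c → Atₛ c → a ⊲ₛ c → ¬ (c ⊲ₛ b))
      pred : ∀ a → Atₛ a → (∃[ b ] (Atₛ b × b ⊲ₛ a)) →
             ∃[ b ] (Atₛ b × b ⊲ₛ a × ∀ c → Atₛ c → c ⊲ₛ a → ¬ (b ⊲ₛ c))
      least : ∀ X → X ≢ botₛ →
              ∃[ x ] (Atₛ x × x ⊆ₛ X × ∀ y → Atₛ y → y ⊆ₛ X → (x ≡ y) ⊎ (x ⊲ₛ y))

module Submission where

-- Call I ∈ M good if M, with quantifiers restricted to the elements below I, is
-- ≈ₖ-equivalent to some MSO(n), witnessed by a winning strategy for player II.  There are only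
-- finitely many Hintikka formulas (k-types) of sentences, and two structures realising the same
-- one are ≈ₖ-equivalent; so "I is good" is expressed by the disjunction of the relativisations to I
-- of those types that are realised in some MSO(n).  Hence "the initial segment ending at the atom x
-- is good" is a definable property of x, and the least-element axiom together with comprehension
-- lets us prove it by induction along ⊲.  The segment ending at x is the segment below x
-- (good by induction via the immediate predecessor, or empty) with one new greatest point, and
-- adjoining a greatest point to both sides preserves II's strategy, MSO(n + 1) being MSO(n) with a
-- new greatest point.  The segment ending at the last atom is the whole of M.

open import Algebra.Lattice.Bundles using (BooleanAlgebra)
import Algebra.Lattice.Properties.BooleanAlgebra as BooleanAlgebraProperties
import Algebra.Lattice.Properties.Lattice as LatticeProperties
open import Axiom.ExcludedMiddle using (ExcludedMiddle)
open import Data.Bool using (Bool; true; false)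
open import Data.Empty using (⊥-elim)
open import Data.Fin as Fin using (Fin; zero; suc; inject₁; fromℕ)
open import Data.Fin.Properties using (toℕ-inject₁; toℕ-fromℕ; toℕ<n)
open import Data.Fin.Subset as S using (Subset; ⁅_⁆; Nonempty) renaming (_∈_ to _∈ₛ_)
open import Data.Fin.Subset.Properties using (∉⊥; nonempty?; Empty-unique)
open import Data.List using (List; []; _∷_; _++_; map; foldr; filter; concatMap; cartesianProductWith; allFin)
open import Data.List.Membership.Propositional using (_∈_; find; lose)
open import Data.List.Membership.Propositional.Properties
  using ( ∈-map⁺; ∈-filter⁺; ∈-filter⁻; ∈-++⁺ˡ; ∈-++⁺ʳ; ∈-allFin; ∈-concatMap⁺
        ; ∈-cartesianProductWith⁺; ∈-cartesianProductWith⁻)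
open import Data.List.Relation.Unary.All as All using (All; []; _∷_)
import Data.List.Relation.Unary.All.Properties as All
open import Data.List.Relation.Unary.Any as Any using (Any; here; there)
import Data.List.Relation.Unary.Any.Properties as Any
open import Data.Nat as ℕ using (ℕ; zero; suc; _≤_; z≤n; s≤s)
open import Data.Nat.Properties using (⊔-lub; m⊔n≤o⇒m≤o; m⊔n≤o⇒n≤o; <-asym; <-irrefl)
open import Data.Product using (Σ; ∃-syntax; _×_; _,_; proj₁; proj₂)
open import Data.Sum using (_⊎_; inj₁; inj₂; [_,_]′; swap)
open import Data.Unit using (⊤; tt)
open import Data.Vec using ([]; _∷_; _∷ʳ_; initLast; here; there)
open import Data.Vec.Properties using (∷ʳ-injective)
open import Data.Vec.Functional using () renaming (_∷_ to _∷ᵛ_)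
open import Function using (_∘_)
open import Level using (0ℓ)
open import Relation.Binary.Bundles using (Poset)
open import Relation.Binary.Lattice using (IsLattice)
open import Relation.Binary.PropositionalEquality
  using (_≡_; _≢_; refl; sym; trans; cong; cong₂; subst; module ≡-Reasoning)
open import Relation.Nullary using (¬_; yes; no)

open import Defs

⇔-refl : ∀ {P} → P ⇔ P
⇔-refl = (λ p → p) , (λ p → p)

⇔-sym : ∀ {P Q} → P ⇔ Q → Q ⇔ P
⇔-sym (f , g) = g , f

⇔-trans : ∀ {P Q R} → P ⇔ Q → Q ⇔ R → P ⇔ R
⇔-trans (f , g) (h , k) = h ∘ f , g ∘ k

≡⇒⇔ : ∀ {P Q} → P ≡ Q → P ⇔ Q
≡⇒⇔ refl = ⇔-refl

¬-⇔ : ∀ {P Q} → P ⇔ Q → (¬ P) ⇔ (¬ Q)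
¬-⇔ (f , g) = (λ np → np ∘ g) , (λ nq → nq ∘ f)

×-⇔ : ∀ {P Q R S} → P ⇔ Q → R ⇔ S → (P × R) ⇔ (Q × S)
×-⇔ (f , g) (h , k) = (λ (p , r) → f p , h r) , (λ (q , s) → g q , k s)

⊎-⇔ : ∀ {P Q R S} → P ⇔ Q → R ⇔ S → (P ⊎ R) ⇔ (Q ⊎ S)
⊎-⇔ (f , g) (h , k) = Data.Sum.map f h , Data.Sum.map g k

→-⇔ : ∀ {P Q R S} → P ⇔ Q → R ⇔ S → (P → R) ⇔ (Q → S)
→-⇔ (f , g) (h , k) = (λ pr → h ∘ pr ∘ g) , (λ qs → k ∘ qs ∘ f)

⇔-both : ∀ {P Q : Set} → P → Q → P ⇔ Q
⇔-both p q = (λ _ → q) , (λ _ → p)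

⇔-neither : ∀ {P Q : Set} → ¬ P → ¬ Q → P ⇔ Q
⇔-neither ¬p ¬q = ⊥-elim ∘ ¬p , ⊥-elim ∘ ¬q

through : ∀ {P Q R S} → P ⇔ R → R ⇔ S → Q ⇔ S → P ⇔ Q
through p⇔r r⇔s q⇔s = ⇔-trans p⇔r (⇔-trans r⇔s (⇔-sym q⇔s))

Π-⇔ : ∀ {A : Set} {P Q : A → Set} → (∀ a → P a ⇔ Q a) → (∀ a → P a) ⇔ (∀ a → Q a)
Π-⇔ h = (λ p a → proj₁ (h a) (p a)) , (λ q a → proj₂ (h a) (q a))

Σ-⇔ : ∀ {A : Set} {P Q : A → Set} → (∀ a → P a ⇔ Q a) → Σ A P ⇔ Σ A Q
Σ-⇔ h = (λ (a , p) → a , proj₁ (h a) p) , (λ (a , q) → a , proj₂ (h a) q)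

All-⇔ : ∀ {A : Set} {P Q : A → Set} {xs} → (∀ x → P x ⇔ Q x) → All P xs ⇔ All Q xs
All-⇔ h = All.map (proj₁ (h _)) , All.map (proj₂ (h _))

record Restricted : Set₁ where
  constructor _↾_
  field
    structure : Structure
    Dom       : Structure.Carrier structure → Set

  open Structure structure public

Env↾ : Restricted → ℕ → Set
Env↾ A = Env (Restricted.structure A)

total : Structure → Restricted
total N = N ↾ λ _ → ⊤

module _ (A : Restricted) where
  open Restricted A

  Sat↾ : ∀ {n} → Env structure n → Formula n → Set
  Sat↾ ρ (t ≐ u)  = evalT structure ρ t ≡ evalT structure ρ u
  Sat↾ ρ (t ⊆' u) = evalT structure ρ t ⊆ₛ evalT structure ρ u
  Sat↾ ρ (t ⊲' u) = evalT structure ρ t ⊲ₛ evalT structure ρ u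
  Sat↾ ρ (At' t)  = Atₛ (evalT structure ρ t)
  Sat↾ ρ (¬' φ)   = ¬ Sat↾ ρ φ
  Sat↾ ρ (φ ∧' ψ) = Sat↾ ρ φ × Sat↾ ρ ψ
  Sat↾ ρ (φ ∨' ψ) = Sat↾ ρ φ ⊎ Sat↾ ρ ψ
  Sat↾ ρ (φ ⇒' ψ) = Sat↾ ρ φ → Sat↾ ρ ψ
  Sat↾ ρ (∀' φ)   = ∀ a → Dom a → Sat↾ (extend structure a ρ) φ
  Sat↾ ρ (∃' φ)   = Σ Carrier λ a → Dom a × Sat↾ (extend structure a ρ) φ

module _ (N : Structure) {D : Structure.Carrier N → Set} (everywhere : ∀ a → D a) where

  Sat⇔Sat↾ : ∀ {n} (ρ : Env N n) φ → Sat N ρ φ ⇔ Sat↾ (N ↾ D) ρ φ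
  Sat⇔Sat↾ ρ (t ≐ u)  = ⇔-refl
  Sat⇔Sat↾ ρ (t ⊆' u) = ⇔-refl
  Sat⇔Sat↾ ρ (t ⊲' u) = ⇔-refl
  Sat⇔Sat↾ ρ (At' t)  = ⇔-refl
  Sat⇔Sat↾ ρ (¬' φ)   = ¬-⇔ (Sat⇔Sat↾ ρ φ)
  Sat⇔Sat↾ ρ (φ ∧' ψ) = ×-⇔ (Sat⇔Sat↾ ρ φ) (Sat⇔Sat↾ ρ ψ)
  Sat⇔Sat↾ ρ (φ ∨' ψ) = ⊎-⇔ (Sat⇔Sat↾ ρ φ) (Sat⇔Sat↾ ρ ψ)
  Sat⇔Sat↾ ρ (φ ⇒' ψ) = →-⇔ (Sat⇔Sat↾ ρ φ) (Sat⇔Sat↾ ρ ψ)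
  Sat⇔Sat↾ ρ (∀' φ)   = ⇔-trans (Π-⇔ λ a → Sat⇔Sat↾ (extend N a ρ) φ)
                                  ((λ h a _ → h a) , (λ h a → h a (everywhere a)))
  Sat⇔Sat↾ ρ (∃' φ)   = ⇔-trans (Σ-⇔ λ a → Sat⇔Sat↾ (extend N a ρ) φ)
                                  ((λ (a , s) → a , everywhere a , s) , (λ (a , _ , s) → a , s))

renameT : ∀ {m n} → (Fin m → Fin n) → Term m → Term n
renameT f (var i) = var (f i)
renameT f botT    = botT

relativise : ∀ {m n} → (Fin m → Fin n) → Fin n → Formula m → Formula n
relativise f p (t ≐ u)  = renameT f t ≐ renameT f u
relativise f p (t ⊆' u) = renameT f t ⊆' renameT f u
relativise f p (t ⊲' u) = renameT f t ⊲' renameT f u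
relativise f p (At' t)  = At' (renameT f t)
relativise f p (¬' φ)   = ¬' relativise f p φ
relativise f p (φ ∧' ψ) = relativise f p φ ∧' relativise f p ψ
relativise f p (φ ∨' ψ) = relativise f p φ ∨' relativise f p ψ
relativise f p (φ ⇒' ψ) = relativise f p φ ⇒' relativise f p ψ
relativise f p (∀' φ)   = ∀' ((var zero ⊆' var (suc p)) ⇒' relativise (Fin.lift 1 f) (suc p) φ)
relativise f p (∃' φ)   = ∃' ((var zero ⊆' var (suc p)) ∧' relativise (Fin.lift 1 f) (suc p) φ)

module _ (N : Structure) where
  open Structure N

  evalT-renameT : ∀ {m n} {f : Fin m → Fin n} {ρ : Env N n} {σ : Env N m} →
                  (∀ i → σ i ≡ ρ (f i)) → ∀ t → evalT N ρ (renameT f t) ≡ evalT N σ t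
  evalT-renameT σ≗ρ∘f (var i) = sym (σ≗ρ∘f i)
  evalT-renameT σ≗ρ∘f botT    = refl

  extend-lift : ∀ {m n} {f : Fin m → Fin n} {ρ : Env N n} {σ : Env N m} a →
                (∀ i → σ i ≡ ρ (f i)) → ∀ i → extend N a σ i ≡ extend N a ρ (Fin.lift 1 f i)
  extend-lift a e zero    = refl
  extend-lift a e (suc i) = e i

  Sat-relativise : ∀ {m n} (f : Fin m → Fin n) (p : Fin n) {ρ : Env N n} {σ : Env N m} →
                   (∀ i → σ i ≡ ρ (f i)) →
                   ∀ φ → Sat N ρ (relativise f p φ) ⇔ Sat↾ (N ↾ (_⊆ₛ ρ p)) σ φ
  Sat-relativise f p e (t ≐ u)  = ≡⇒⇔ (cong₂ _≡_ (evalT-renameT e t) (evalT-renameT e u))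
  Sat-relativise f p e (t ⊆' u) = ≡⇒⇔ (cong₂ _⊆ₛ_ (evalT-renameT e t) (evalT-renameT e u))
  Sat-relativise f p e (t ⊲' u) = ≡⇒⇔ (cong₂ _⊲ₛ_ (evalT-renameT e t) (evalT-renameT e u))
  Sat-relativise f p e (At' t)  = ≡⇒⇔ (cong Atₛ (evalT-renameT e t))
  Sat-relativise f p e (¬' φ)   = ¬-⇔ (Sat-relativise f p e φ)
  Sat-relativise f p e (φ ∧' ψ) = ×-⇔ (Sat-relativise f p e φ) (Sat-relativise f p e ψ)
  Sat-relativise f p e (φ ∨' ψ) = ⊎-⇔ (Sat-relativise f p e φ) (Sat-relativise f p e ψ)
  Sat-relativise f p e (φ ⇒' ψ) = →-⇔ (Sat-relativise f p e φ) (Sat-relativise f p e ψ)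
  Sat-relativise f p e (∀' φ)   =
    Π-⇔ λ a → →-⇔ ⇔-refl (Sat-relativise (Fin.lift 1 f) (suc p) (extend-lift a e) φ)
  Sat-relativise f p e (∃' φ)   =
    Σ-⇔ λ a → ×-⇔ ⇔-refl (Sat-relativise (Fin.lift 1 f) (suc p) (extend-lift a e) φ)

data Atomic (m : ℕ) : Set where
  eqᵃ subᵃ ltᵃ : Fin m → Fin m → Atomic m
  botᵃ atᵃ     : Fin m → Atomic m

atomicFormula : ∀ {m} → Atomic m → Formula m
atomicFormula (eqᵃ i j)  = var i ≐ var j
atomicFormula (subᵃ i j) = var i ⊆' var j
atomicFormula (ltᵃ i j)  = var i ⊲' var j
atomicFormula (botᵃ i)   = var i ≐ botT
atomicFormula (atᵃ i)    = At' (var i)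

Unnested≤ : ℕ → ∀ {m} → Formula m → Set
Unnested≤ k φ = Unnested φ × qr φ ≤ k

atomic-unnested : ∀ {k m} (c : Atomic m) → Unnested≤ k (atomicFormula c)
atomic-unnested (eqᵃ i j)  = u-eq i j , z≤n
atomic-unnested (subᵃ i j) = u-sub i j , z≤n
atomic-unnested (ltᵃ i j)  = u-lt i j , z≤n
atomic-unnested (botᵃ i)   = u-eqbot i , z≤n
atomic-unnested (atᵃ i)    = u-at i , z≤n

allAtomic : ∀ m → List (Atomic m)
allAtomic m = concatMap (λ i → botᵃ i ∷ atᵃ i ∷ concatMap (binary i) (allFin m)) (allFin m)
  where
  binary : Fin m → Fin m → List (Atomic m)
  binary i j = eqᵃ i j ∷ subᵃ i j ∷ ltᵃ i j ∷ []

∈-concatMap-allFin : ∀ {m} {A : Set} {f : Fin m → List A} {x} i →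
                     x ∈ f i → x ∈ concatMap f (allFin m)
∈-concatMap-allFin {f = f} i x∈fi = ∈-concatMap⁺ f (Any.map (λ { refl → x∈fi }) (∈-allFin i))

∈-allAtomic : ∀ {m} (c : Atomic m) → c ∈ allAtomic m
∈-allAtomic (botᵃ i)   = ∈-concatMap-allFin i (here refl)
∈-allAtomic (atᵃ i)    = ∈-concatMap-allFin i (there (here refl))
∈-allAtomic (eqᵃ i j)  = ∈-concatMap-allFin i (there (there (∈-concatMap-allFin j (here refl))))
∈-allAtomic (subᵃ i j) = ∈-concatMap-allFin i (there (there (∈-concatMap-allFin j (there (here refl)))))
∈-allAtomic (ltᵃ i j)  =
  ∈-concatMap-allFin i (there (there (∈-concatMap-allFin j (there (there (here refl))))))

⊤' : ∀ {n} → Formula (suc n)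
⊤' = var zero ≐ var zero

⋀ ⋁ : ∀ {n} → List (Formula (suc n)) → Formula (suc n)
⋀ = foldr _∧'_ ⊤'
⋁ = foldr _∨'_ (¬' ⊤')

⋀-unnested : ∀ {k n} {φs : List (Formula (suc n))} → All (Unnested≤ k) φs → Unnested≤ k (⋀ φs)
⋀-unnested []              = u-eq zero zero , z≤n
⋀-unnested ((u , q) ∷ ps) = let (u′ , q′) = ⋀-unnested ps in u-and u u′ , ⊔-lub q q′

module _ (A : Restricted) {n} {ρ : Env↾ A (suc n)} where

  Sat↾-⋀ : ∀ φs → Sat↾ A ρ (⋀ φs) ⇔ All (Sat↾ A ρ) φs
  Sat↾-⋀ []       = (λ _ → []) , (λ _ → refl)
  Sat↾-⋀ (φ ∷ φs) =
    ⇔-trans (×-⇔ ⇔-refl (Sat↾-⋀ φs)) ((λ (s , ss) → s ∷ ss) , (λ { (s ∷ ss) → s , ss }))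

module _ (N : Structure) {n} {ρ : Env N (suc n)} where

  Sat-⋀ : ∀ φs → Sat N ρ (⋀ φs) ⇔ All (Sat N ρ) φs
  Sat-⋀ []       = (λ _ → []) , (λ _ → refl)
  Sat-⋀ (φ ∷ φs) =
    ⇔-trans (×-⇔ ⇔-refl (Sat-⋀ φs)) ((λ (s , ss) → s ∷ ss) , (λ { (s ∷ ss) → s , ss }))

  Sat-⋁ : ∀ φs → Sat N ρ (⋁ φs) ⇔ Any (Sat N ρ) φs
  Sat-⋁ []       = (λ s → ⊥-elim (s refl)) , (λ ())
  Sat-⋁ (φ ∷ φs) =
    ⇔-trans (⊎-⇔ ⇔-refl (Sat-⋁ φs)) ([ here , there ]′ , λ { (here s) → inj₁ s ; (there s) → inj₂ s })

Sat↾-atomic-cong : ∀ (A : Restricted) {m} {ρ ρ′ : Env↾ A m} →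
                   (∀ i → ρ i ≡ ρ′ i) →
                   ∀ c → Sat↾ A ρ (atomicFormula c) ⇔ Sat↾ A ρ′ (atomicFormula c)
Sat↾-atomic-cong A ρ≗ (eqᵃ i j)  = ≡⇒⇔ (cong₂ _≡_ (ρ≗ i) (ρ≗ j))
Sat↾-atomic-cong A ρ≗ (subᵃ i j) = ≡⇒⇔ (cong₂ (Restricted._⊆ₛ_ A) (ρ≗ i) (ρ≗ j))
Sat↾-atomic-cong A ρ≗ (ltᵃ i j)  = ≡⇒⇔ (cong₂ (Restricted._⊲ₛ_ A) (ρ≗ i) (ρ≗ j))
Sat↾-atomic-cong A ρ≗ (botᵃ i)   = ≡⇒⇔ (cong (_≡ Restricted.botₛ A) (ρ≗ i))
Sat↾-atomic-cong A ρ≗ (atᵃ i)    = ≡⇒⇔ (cong (Restricted.Atₛ A) (ρ≗ i))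

-- Ehrenfeucht–Fraïssé games

module Game (A B : Restricted) where
  private
    module A = Restricted A
    module B = Restricted B

  Agree : ∀ {m} → Env↾ A m → Env↾ B m → Set
  Agree ρ σ = ∀ c → Sat↾ A ρ (atomicFormula c) ⇔ Sat↾ B σ (atomicFormula c)

  IIWins : ℕ → ∀ {m} → Env↾ A m → Env↾ B m → Set
  IIWins zero    ρ σ = Agree ρ σ
  IIWins (suc k) ρ σ = Agree ρ σ
    × (∀ a → A.Dom a → ∃[ b ] (B.Dom b × IIWins k (extend A.structure a ρ) (extend B.structure b σ)))
    × (∀ b → B.Dom b → ∃[ a ] (A.Dom a × IIWins k (extend A.structure a ρ) (extend B.structure b σ)))

  IIWins⇒Agree : ∀ k {m} {ρ : Env↾ A m} {σ} → IIWins k ρ σ → Agree ρ σ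
  IIWins⇒Agree zero    g = g
  IIWins⇒Agree (suc k) g = proj₁ g

  Agree-cong : ∀ {m} {ρ ρ′ : Env↾ A m} {σ σ′} →
               (∀ i → ρ i ≡ ρ′ i) → (∀ i → σ i ≡ σ′ i) → Agree ρ σ → Agree ρ′ σ′
  Agree-cong ρ≗ σ≗ g c = through (⇔-sym (Sat↾-atomic-cong A ρ≗ c)) (g c) (⇔-sym (Sat↾-atomic-cong B σ≗ c))

  IIWins-cong : ∀ k {m} {ρ ρ′ : Env↾ A m} {σ σ′} →
                (∀ i → ρ i ≡ ρ′ i) → (∀ i → σ i ≡ σ′ i) → IIWins k ρ σ → IIWins k ρ′ σ′
  IIWins-cong zero    ρ≗ σ≗ g                   = Agree-cong ρ≗ σ≗ g
  IIWins-cong (suc k) ρ≗ σ≗ (g , forth , back) =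
    Agree-cong ρ≗ σ≗ g ,
    (λ a d → let (b , d′ , g′) = forth a d in b , d′ , IIWins-cong k (extend-≗ ρ≗) (extend-≗ σ≗) g′) ,
    (λ b d → let (a , d′ , g′) = back b d  in a , d′ , IIWins-cong k (extend-≗ ρ≗) (extend-≗ σ≗) g′)
    where
    extend-≗ : ∀ {N : Structure} {m} {ρ ρ′ : Env N m} {a} →
               (∀ i → ρ i ≡ ρ′ i) → ∀ i → extend N a ρ i ≡ extend N a ρ′ i
    extend-≗ ρ≗ zero    = refl
    extend-≗ ρ≗ (suc i) = ρ≗ i

  IIWins-sound : ∀ k {m} {ρ : Env↾ A m} {σ} → IIWins k ρ σ →
                 ∀ {φ} → Unnested φ → qr φ ≤ k → Sat↾ A ρ φ ⇔ Sat↾ B σ φ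
  IIWins-sound k g (u-eq i j)  _ = IIWins⇒Agree k g (eqᵃ i j)
  IIWins-sound k g (u-eqbot i) _ = IIWins⇒Agree k g (botᵃ i)
  IIWins-sound k g (u-at i)    _ = IIWins⇒Agree k g (atᵃ i)
  IIWins-sound k g (u-sub i j) _ = IIWins⇒Agree k g (subᵃ i j)
  IIWins-sound k g (u-lt i j)  _ = IIWins⇒Agree k g (ltᵃ i j)
  IIWins-sound k g (u-not u)   q = ¬-⇔ (IIWins-sound k g u q)
  IIWins-sound k g (u-and {φ} {ψ} u v) q =
    ×-⇔ (IIWins-sound k g u (m⊔n≤o⇒m≤o (qr φ) (qr ψ) q))
        (IIWins-sound k g v (m⊔n≤o⇒n≤o (qr φ) (qr ψ) q))
  IIWins-sound k g (u-or {φ} {ψ} u v) q =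
    ⊎-⇔ (IIWins-sound k g u (m⊔n≤o⇒m≤o (qr φ) (qr ψ) q))
        (IIWins-sound k g v (m⊔n≤o⇒n≤o (qr φ) (qr ψ) q))
  IIWins-sound k g (u-imp {φ} {ψ} u v) q =
    →-⇔ (IIWins-sound k g u (m⊔n≤o⇒m≤o (qr φ) (qr ψ) q))
        (IIWins-sound k g v (m⊔n≤o⇒n≤o (qr φ) (qr ψ) q))
  IIWins-sound (suc k) (_ , forth , back) (u-all u) (s≤s q) =
    (λ h b d → let (a , d′ , g′) = back b d in proj₁ (IIWins-sound k g′ u q) (h a d′)) ,
    (λ h a d → let (b , d′ , g′) = forth a d in proj₂ (IIWins-sound k g′ u q) (h b d′))
  IIWins-sound (suc k) (_ , forth , back) (u-ex u) (s≤s q) =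
    (λ (a , d , s) → let (b , d′ , g′) = forth a d in b , d′ , proj₁ (IIWins-sound k g′ u q) s) ,
    (λ (b , d , s) → let (a , d′ , g′) = back b d in a , d′ , proj₂ (IIWins-sound k g′ u q) s)

-- Hintikka formulas

signs : ∀ {n} → List (Formula n) → List (List (Formula n))
signs []       = [] ∷ []
signs (φ ∷ φs) = cartesianProductWith _∷_ (φ ∷ ¬' φ ∷ []) (signs φs)

signs-All : ∀ {n} {P : Formula n → Set} → (∀ {φ} → P φ → P (¬' φ)) →
            ∀ {φs t} → All P φs → t ∈ signs φs → All P t
signs-All neg {[]}     []       (here refl) = []
signs-All neg {φ ∷ φs} (p ∷ ps) t∈
  with ∈-cartesianProductWith⁻ _∷_ (φ ∷ ¬' φ ∷ []) (signs φs) t∈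
... | _ , _ , here refl ,         t′∈ , refl = p ∷ signs-All neg ps t′∈
... | _ , _ , there (here refl) , t′∈ , refl = neg p ∷ signs-All neg ps t′∈

signs-decide : ∀ {n} {φs t : List (Formula n)} {φ} →
               t ∈ signs φs → φ ∈ φs → φ ∈ t ⊎ ¬' φ ∈ t
signs-decide {φs = ψ ∷ φs} t∈ φ∈
  with ∈-cartesianProductWith⁻ _∷_ (ψ ∷ ¬' ψ ∷ []) (signs φs) t∈ | φ∈
... | _ , _ , here refl ,         _ ,   refl | here refl  = inj₁ (here refl)
... | _ , _ , there (here refl) , _ ,   refl | here refl  = inj₂ (here refl)
... | _ , _ , _ ,                 t′∈ , refl | there φ∈′ = Data.Sum.map there there (signs-decide t′∈ φ∈′)

signs-agree : ∀ (A B : Restricted) {m} {ρ : Env↾ A m} {σ : Env↾ B m}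
              {φs t φ} → t ∈ signs φs → φ ∈ φs → All (Sat↾ A ρ) t → All (Sat↾ B σ) t →
              Sat↾ A ρ φ ⇔ Sat↾ B σ φ
signs-agree A B t∈ φ∈ sA sB with signs-decide t∈ φ∈
... | inj₁ φ∈t  = (λ _ → All.lookup sB φ∈t) , (λ _ → All.lookup sA φ∈t)
... | inj₂ ¬φ∈t = ⊥-elim ∘ All.lookup sA ¬φ∈t , ⊥-elim ∘ All.lookup sB ¬φ∈t

atomics : ∀ m → List (Formula m)
atomics m = map atomicFormula (allAtomic m)

atomics-unnested : ∀ {k m} → All (Unnested≤ k) (atomics m)
atomics-unnested = All.map⁺ (All.tabulate λ {c} _ → atomic-unnested c)

¬-unnested : ∀ {k n} {φ : Formula n} → Unnested≤ k φ → Unnested≤ k (¬' φ)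
¬-unnested (u , q) = u-not u , q

atomic∈atomics : ∀ {m} (c : Atomic m) → atomicFormula c ∈ atomics m
atomic∈atomics c = ∈-map⁺ atomicFormula (∈-allAtomic c)

-- A rank-(k+1) type decides ∃x τ for every rank-k type τ; since every one-point extension of
-- the assignment realises some τ, this already determines player II's answers.
types : ℕ → ∀ m → List (List (Formula m))
types zero    m = signs (atomics m)
types (suc k) m = signs (atomics m ++ map (∃' ∘ ⋀) (types k (suc m)))

types-unnested : ∀ k m {t} → t ∈ types k m → All (Unnested≤ k) t
types-unnested zero    m = signs-All ¬-unnested atomics-unnested
types-unnested (suc k) m =
  signs-All ¬-unnested (All.++⁺ atomics-unnested (All.map⁺ (All.tabulate ∃⋀-unnested)))
  where
  ∃⋀-unnested : ∀ {t} → t ∈ types k (suc m) → Unnested≤ (suc k) (∃' (⋀ t))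
  ∃⋀-unnested t∈ = let (u , q) = ⋀-unnested (types-unnested k (suc m) t∈) in u-ex u , s≤s q

module _ (lem : ExcludedMiddle 0ℓ) where

  signs-realised : ∀ A {m} (ρ : Env↾ A m) φs → ∃[ t ] (t ∈ signs φs × All (Sat↾ A ρ) t)
  signs-realised A ρ []       = [] , here refl , []
  signs-realised A ρ (φ ∷ φs) with signs-realised A ρ φs | lem {Sat↾ A ρ φ}
  ... | t , t∈ , s | yes sφ  =
    φ ∷ t , ∈-cartesianProductWith⁺ _∷_ {φ ∷ ¬' φ ∷ []} (here refl) t∈ , sφ ∷ s
  ... | t , t∈ , s | no ¬sφ =
    ¬' φ ∷ t , ∈-cartesianProductWith⁺ _∷_ {φ ∷ ¬' φ ∷ []} (there (here refl)) t∈ , ¬sφ ∷ s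

  type-realised : ∀ k m A (ρ : Env↾ A m) → ∃[ t ] (t ∈ types k m × All (Sat↾ A ρ) t)
  type-realised zero    m A ρ = signs-realised A ρ (atomics m)
  type-realised (suc k) m A ρ = signs-realised A ρ (atomics m ++ map (∃' ∘ ⋀) (types k (suc m)))

  module _ (A B : Restricted) where
    open Game A B
    private
      module A = Restricted A
      module B = Restricted B

    sameType⇒IIWins : ∀ k {m} {ρ : Env↾ A m} {σ : Env↾ B m} {t} → t ∈ types k m →
                      All (Sat↾ A ρ) t → All (Sat↾ B σ) t → IIWins k ρ σ
    sameType⇒IIWins zero    t∈ sA sB = λ c → signs-agree A B t∈ (atomic∈atomics c) sA sB
    sameType⇒IIWins (suc k) {m} {ρ} {σ} t∈ sA sB =
      (λ c → signs-agree A B t∈ (∈-++⁺ˡ (atomic∈atomics c)) sA sB) , forth , back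
      where
      ∃⋀∈ : ∀ {t′} → t′ ∈ types k (suc m) →
            ∃' (⋀ t′) ∈ atomics m ++ map (∃' ∘ ⋀) (types k (suc m))
      ∃⋀∈ t′∈ = ∈-++⁺ʳ (atomics m) (∈-map⁺ (∃' ∘ ⋀) t′∈)

      forth : ∀ a → A.Dom a →
              ∃[ b ] (B.Dom b × IIWins k (extend A.structure a ρ) (extend B.structure b σ))
      forth a d =
        let (t′ , t′∈ , sa) = type-realised k (suc m) A (extend A.structure a ρ)
            (b , d′ , sb)   =
              proj₁ (signs-agree A B t∈ (∃⋀∈ t′∈) sA sB) (a , d , proj₂ (Sat↾-⋀ A t′) sa)
        in b , d′ , sameType⇒IIWins k t′∈ sa (proj₁ (Sat↾-⋀ B t′) sb)

      back : ∀ b → B.Dom b →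
             ∃[ a ] (A.Dom a × IIWins k (extend A.structure a ρ) (extend B.structure b σ))
      back b d =
        let (t′ , t′∈ , sb) = type-realised k (suc m) B (extend B.structure b σ)
            (a , d′ , sa)   =
              proj₂ (signs-agree A B t∈ (∃⋀∈ t′∈) sA sB) (b , d , proj₂ (Sat↾-⋀ B t′) sb)
        in a , d′ , sameType⇒IIWins k t′∈ (proj₁ (Sat↾-⋀ A t′) sa) sb

-- Adjoining a new greatest point

-- B is A with one new point above all atoms of A; join X e adds that point to X when e is true.
record Extension (A B : Restricted) : Set where
  private
    module A = Restricted A
    module B = Restricted B
  field
    join     : A.Carrier → Bool → B.Carrier
    join-dom : ∀ {X} e → A.Dom X → B.Dom (join X e)
    split    : ∀ Y → B.Dom Y → ∃[ X ] ∃[ e ] (A.Dom X × Y ≡ join X e)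
    join-≡   : ∀ {X Y} e f → A.Dom X → A.Dom Y → (join X e ≡ join Y f) ⇔ (X ≡ Y × e ≡ f)
    join-≡⊥  : ∀ {X} e → A.Dom X → (join X e ≡ B.botₛ) ⇔ (X ≡ A.botₛ × e ≡ false)
    join-At  : ∀ {X} e → A.Dom X →
               B.Atₛ (join X e) ⇔ ((A.Atₛ X × e ≡ false) ⊎ (X ≡ A.botₛ × e ≡ true))
    join-⊆   : ∀ {X Y} e f → A.Dom X → A.Dom Y →
               (join X e B.⊆ₛ join Y f) ⇔ (X A.⊆ₛ Y × (e ≡ true → f ≡ true))
    join-⊲   : ∀ {X Y} e f → A.Dom X → A.Dom Y →
               (join X e B.⊲ₛ join Y f) ⇔ (X A.⊲ₛ Y ⊎ (X ≢ A.botₛ × f ≡ true))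

extend-dom : ∀ {N : Structure} {D : Structure.Carrier N → Set} {m} {ρ : Env N m} {a} →
             D a → (∀ i → D (ρ i)) → ∀ i → D (extend N a ρ i)
extend-dom da dρ zero    = da
extend-dom da dρ (suc i) = dρ i

module _ {A A′ B B′ : Restricted} (EA : Extension A A′) (EB : Extension B B′) where
  private
    module A = Restricted A
    module B = Restricted B
    module A′ = Restricted A′
    module B′ = Restricted B′
    module EA = Extension EA
    module EB = Extension EB
  open Game

  Agree-extend : ∀ {m} {ρ : Env↾ A m} {σ : Env↾ B m} (e : Fin m → Bool) →
                 (∀ i → A.Dom (ρ i)) → (∀ i → B.Dom (σ i)) → Agree A B ρ σ →
                 Agree A′ B′ (λ i → EA.join (ρ i) (e i)) (λ i → EB.join (σ i) (e i))
  Agree-extend e dρ dσ g (eqᵃ i j)  =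
    through (EA.join-≡ (e i) (e j) (dρ i) (dρ j)) (×-⇔ (g (eqᵃ i j)) ⇔-refl)
            (EB.join-≡ (e i) (e j) (dσ i) (dσ j))
  Agree-extend e dρ dσ g (subᵃ i j) =
    through (EA.join-⊆ (e i) (e j) (dρ i) (dρ j)) (×-⇔ (g (subᵃ i j)) ⇔-refl)
            (EB.join-⊆ (e i) (e j) (dσ i) (dσ j))
  Agree-extend e dρ dσ g (ltᵃ i j)  =
    through (EA.join-⊲ (e i) (e j) (dρ i) (dρ j)) (⊎-⇔ (g (ltᵃ i j)) (×-⇔ (¬-⇔ (g (botᵃ i))) ⇔-refl))
            (EB.join-⊲ (e i) (e j) (dσ i) (dσ j))
  Agree-extend e dρ dσ g (botᵃ i)   =
    through (EA.join-≡⊥ (e i) (dρ i)) (×-⇔ (g (botᵃ i)) ⇔-refl) (EB.join-≡⊥ (e i) (dσ i))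
  Agree-extend e dρ dσ g (atᵃ i)    =
    through (EA.join-At (e i) (dρ i)) (⊎-⇔ (×-⇔ (g (atᵃ i)) ⇔-refl) (×-⇔ (g (botᵃ i)) ⇔-refl))
            (EB.join-At (e i) (dσ i))

  IIWins-extend : ∀ k {m} {ρ : Env↾ A m} {σ : Env↾ B m} (e : Fin m → Bool) →
                  (∀ i → A.Dom (ρ i)) → (∀ i → B.Dom (σ i)) → IIWins A B k ρ σ →
                  IIWins A′ B′ k (λ i → EA.join (ρ i) (e i)) (λ i → EB.join (σ i) (e i))
  IIWins-extend zero    e dρ dσ g                  = Agree-extend e dρ dσ g
  IIWins-extend (suc k) {m} {ρ} {σ} e dρ dσ (g , forth , back) = Agree-extend e dρ dσ g , forth′ , back′
    where
    ρ̂ : Env↾ A′ m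
    ρ̂ i = EA.join (ρ i) (e i)
    σ̂ : Env↾ B′ m
    σ̂ i = EB.join (σ i) (e i)

    forth′ : ∀ Y → A′.Dom Y →
             ∃[ Y′ ] (B′.Dom Y′ × IIWins A′ B′ k (extend A′.structure Y ρ̂) (extend B′.structure Y′ σ̂))
    forth′ Y dY =
      let (X , e′ , dX , Y≡) = EA.split Y dY
          (X′ , dX′ , g′)   = forth X dX
      in EB.join X′ e′ , EB.join-dom e′ dX′ ,
         IIWins-cong A′ B′ k (λ { zero → sym Y≡ ; (suc i) → refl }) (λ { zero → refl ; (suc i) → refl })
           (IIWins-extend k (e′ ∷ᵛ e) (extend-dom {D = A.Dom} dX dρ) (extend-dom {D = B.Dom} dX′ dσ) g′)

    back′ : ∀ Y′ → B′.Dom Y′ →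
            ∃[ Y ] (A′.Dom Y × IIWins A′ B′ k (extend A′.structure Y ρ̂) (extend B′.structure Y′ σ̂))
    back′ Y′ dY′ =
      let (X′ , e′ , dX′ , Y′≡) = EB.split Y′ dY′
          (X , dX , g′)         = back X′ dX′
      in EA.join X e′ , EA.join-dom e′ dX ,
         IIWins-cong A′ B′ k (λ { zero → refl ; (suc i) → refl }) (λ { zero → sym Y′≡ ; (suc i) → refl })
           (IIWins-extend k (e′ ∷ᵛ e) (extend-dom {D = A.Dom} dX dρ) (extend-dom {D = B.Dom} dX′ dσ) g′)

data LastView {n} : Fin (suc n) → Set where
  old : ∀ j → LastView (inject₁ j)
  new : LastView (fromℕ n)

lastView : ∀ {n} (i : Fin (suc n)) → LastView i
lastView {zero}  zero    = new
lastView {suc n} zero    = old zero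
lastView {suc n} (suc i) with lastView i
... | old j = old (suc j)
... | new   = new

∈-old : ∀ {n} {j : Fin n} {X : Subset n} {e} → (inject₁ j ∈ₛ X ∷ʳ e) ⇔ (j ∈ₛ X)
∈-old {j = zero}  {x ∷ X} = (λ { here → here }) , (λ { here → here })
∈-old {j = suc j} {x ∷ X} =
  (λ { (there p) → there (proj₁ ∈-old p) }) , (λ { (there p) → there (proj₂ ∈-old p) })

∈-new : ∀ {n} {X : Subset n} {e} → (fromℕ n ∈ₛ X ∷ʳ e) ⇔ (e ≡ true)
∈-new {X = []}    = (λ { here → refl }) , (λ { refl → here })
∈-new {X = x ∷ X} =
  (λ { (there p) → proj₁ (∈-new {X = X}) p }) , (λ e≡ → there (proj₂ (∈-new {X = X}) e≡))

⊥∷ʳfalse : ∀ n → S.⊥ {suc n} ≡ S.⊥ {n} ∷ʳ false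
⊥∷ʳfalse zero    = refl
⊥∷ʳfalse (suc n) = cong (false ∷_) (⊥∷ʳfalse n)

⁅inject₁⁆ : ∀ {n} (j : Fin n) → ⁅ inject₁ j ⁆ ≡ ⁅ j ⁆ ∷ʳ false
⁅inject₁⁆ {suc n} zero    = cong (true ∷_) (⊥∷ʳfalse n)
⁅inject₁⁆         (suc j) = cong (false ∷_) (⁅inject₁⁆ j)

⁅fromℕ⁆ : ∀ n → ⁅ fromℕ n ⁆ ≡ S.⊥ {n} ∷ʳ true
⁅fromℕ⁆ zero    = refl
⁅fromℕ⁆ (suc n) = cong (false ∷_) (⁅fromℕ⁆ n)

inject₁-<-⇔ : ∀ {n} {i j : Fin n} → (inject₁ i Fin.< inject₁ j) ⇔ (i Fin.< j)
inject₁-<-⇔ {i = i} {j} = ≡⇒⇔ (cong₂ ℕ._<_ (toℕ-inject₁ i) (toℕ-inject₁ j))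

inject₁<fromℕ : ∀ {n} (j : Fin n) → inject₁ j Fin.< fromℕ n
inject₁<fromℕ {n} j rewrite toℕ-inject₁ j | toℕ-fromℕ n = toℕ<n j

fromℕ≮ : ∀ {n} (i : Fin (suc n)) → ¬ (fromℕ n Fin.< i)
fromℕ≮ i with lastView i
... | old j = <-asym (inject₁<fromℕ j)
... | new   = <-irrefl refl

nonempty : ∀ {n} {X : Subset n} → X ≢ S.⊥ → Nonempty X
nonempty {X = X} X≢⊥ with nonempty? X
... | yes ne = ne
... | no  ¬ne = ⊥-elim (X≢⊥ (Empty-unique ¬ne))

Subset₀ : (X : Subset 0) → X ≡ []
Subset₀ [] = refl

MSO-extension : ∀ n → Extension (total (MSO n)) (total (MSO (suc n)))
MSO-extension n = record
  { join     = _∷ʳ_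
  ; join-dom = λ _ _ → tt
  ; split    = λ Y _ → let (X , e , Y≡) = initLast Y in X , e , tt , Y≡
  ; join-≡   = λ _ _ _ _ → ∷ʳ-injective _ _ , λ { (refl , refl) → refl }
  ; join-≡⊥  = λ _ _ → (λ X∷ʳe≡⊥ → ∷ʳ-injective _ _ (trans X∷ʳe≡⊥ (⊥∷ʳfalse n))) ,
                       λ { (refl , refl) → sym (⊥∷ʳfalse n) }
  ; join-At  = λ e _ → join-At e
  ; join-⊆   = λ e f _ _ → join-⊆ e f
  ; join-⊲   = λ e f _ _ → join-⊲ e f
  }
  where
  join-At : ∀ {X : Subset n} e →
            (∃[ i ] (X ∷ʳ e ≡ ⁅ i ⁆)) ⇔ (((∃[ i ] (X ≡ ⁅ i ⁆)) × e ≡ false) ⊎ (X ≡ S.⊥ × e ≡ true))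
  join-At {X} e = to , from
    where
    to : ∃[ i ] (X ∷ʳ e ≡ ⁅ i ⁆) → ((∃[ i ] (X ≡ ⁅ i ⁆)) × e ≡ false) ⊎ (X ≡ S.⊥ × e ≡ true)
    to (i , X∷ʳe≡) with lastView i
    ... | old j = let (X≡ , e≡) = ∷ʳ-injective _ _ (trans X∷ʳe≡ (⁅inject₁⁆ j))
                  in inj₁ ((j , X≡) , e≡)
    ... | new   = inj₂ (∷ʳ-injective _ _ (trans X∷ʳe≡ (⁅fromℕ⁆ n)))
    from : ((∃[ i ] (X ≡ ⁅ i ⁆)) × e ≡ false) ⊎ (X ≡ S.⊥ × e ≡ true) → ∃[ i ] (X ∷ʳ e ≡ ⁅ i ⁆)
    from (inj₁ ((j , refl) , refl)) = inject₁ j , sym (⁅inject₁⁆ j)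
    from (inj₂ (refl , refl))        = fromℕ n , sym (⁅fromℕ⁆ n)

  join-⊆ : ∀ {X Y : Subset n} e f → (X ∷ʳ e S.⊆ Y ∷ʳ f) ⇔ (X S.⊆ Y × (e ≡ true → f ≡ true))
  join-⊆ {X} {Y} e f = to , from
    where
    to : X ∷ʳ e S.⊆ Y ∷ʳ f → X S.⊆ Y × (e ≡ true → f ≡ true)
    to X⊆Y = (λ p → proj₁ ∈-old (X⊆Y (proj₂ (∈-old {X = X} {e}) p))) ,
             (λ e≡ → proj₁ (∈-new {X = Y}) (X⊆Y (proj₂ (∈-new {X = X}) e≡)))
    from : X S.⊆ Y × (e ≡ true → f ≡ true) → X ∷ʳ e S.⊆ Y ∷ʳ f
    from (X⊆Y , e⇒f) {i} p with lastView i
    ... | old j = proj₂ (∈-old {X = Y}) (X⊆Y (proj₁ (∈-old {X = X}) p))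
    ... | new   = proj₂ (∈-new {X = Y}) (e⇒f (proj₁ (∈-new {X = X}) p))

  join-⊲ : ∀ {X Y : Subset n} e f →
           (∃[ a ] ∃[ b ] (a ∈ₛ X ∷ʳ e × b ∈ₛ Y ∷ʳ f × a Fin.< b)) ⇔
           ((∃[ a ] ∃[ b ] (a ∈ₛ X × b ∈ₛ Y × a Fin.< b)) ⊎ (X ≢ S.⊥ × f ≡ true))
  join-⊲ {X} {Y} e f = to , from
    where
    to : (∃[ a ] ∃[ b ] (a ∈ₛ X ∷ʳ e × b ∈ₛ Y ∷ʳ f × a Fin.< b)) →
         (∃[ a ] ∃[ b ] (a ∈ₛ X × b ∈ₛ Y × a Fin.< b)) ⊎ (X ≢ S.⊥ × f ≡ true)
    to (a , b , a∈ , b∈ , a<b) with lastView a | lastView b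
    ... | old a′ | old b′ =
      inj₁ (a′ , b′ , proj₁ (∈-old {X = X}) a∈ , proj₁ (∈-old {X = Y}) b∈ , proj₁ inject₁-<-⇔ a<b)
    ... | old a′ | new    =
      inj₂ ((λ X≡⊥ → ∉⊥ (subst (a′ ∈ₛ_) X≡⊥ (proj₁ (∈-old {X = X}) a∈))) , proj₁ (∈-new {X = Y}) b∈)
    ... | new    | _      = ⊥-elim (fromℕ≮ b a<b)
    from : (∃[ a ] ∃[ b ] (a ∈ₛ X × b ∈ₛ Y × a Fin.< b)) ⊎ (X ≢ S.⊥ × f ≡ true) →
           ∃[ a ] ∃[ b ] (a ∈ₛ X ∷ʳ e × b ∈ₛ Y ∷ʳ f × a Fin.< b)
    from (inj₁ (a , b , a∈ , b∈ , a<b)) =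
      inject₁ a , inject₁ b , proj₂ (∈-old {X = X}) a∈ , proj₂ (∈-old {X = Y}) b∈ , proj₂ inject₁-<-⇔ a<b
    from (inj₂ (X≢⊥ , refl)) =
      let (a , a∈) = nonempty X≢⊥ in
      inject₁ a , fromℕ n , proj₂ (∈-old {X = X}) a∈ , proj₂ (∈-new {X = Y}) refl , inject₁<fromℕ a

true⇔true⇒≡ : ∀ {e f : Bool} → (e ≡ true → f ≡ true) → (f ≡ true → e ≡ true) → e ≡ f
true⇔true⇒≡ {false} {false} _ _ = refl
true⇔true⇒≡ {false} {true}  _ f⇒e = f⇒e refl
true⇔true⇒≡ {true}  {f}     e⇒f _ = sym (e⇒f refl)

module Model (lem : ExcludedMiddle 0ℓ) (M : Structure) (TM : ModelsTMSOFin M) where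
  open Structure M
  open ModelsTMSOFin TM
  open ModelsTbase base

  private
    BA : BooleanAlgebra 0ℓ 0ℓ
    BA = let (_∨_ , _∧_ , ∁ , ⊤ , isBA , _) = boolean in record
      { Carrier = Carrier ; _≈_ = _≡_ ; _∨_ = _∨_ ; _∧_ = _∧_ ; ¬_ = ∁ ; ⊤ = ⊤ ; ⊥ = botₛ
      ; isBooleanAlgebra = isBA }

    open BooleanAlgebra BA using (_∨_; _∧_; lattice; ∧-distribˡ-∨; ∨-complementʳ; ∧-complementʳ)
    open BooleanAlgebra BA using () renaming (¬_ to ∁; ⊤ to ⊤ᴮ)
    open BooleanAlgebraProperties BA using (∧-identityʳ; ∨-identityʳ)
    open LatticeProperties lattice using (poset; ∨-∧-isOrderTheoreticLattice)
    open Poset poset using ()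
      renaming (_≤_ to _≼_; refl to ≼-refl; trans to ≼-trans; antisym to ≼-antisym)

    ⊆⇔≡∧ : ∀ x y → x ⊆ₛ y ⇔ (x ∧ y ≡ x)
    ⊆⇔≡∧ = let (_ , _ , _ , _ , _ , ⊆⇔) = boolean in ⊆⇔

    -- The library's lattice order is x ≼ y ⇔ x ≡ x ∧ y, the axioms give x ⊆ y ⇔ x ∧ y ≡ x.
    ⊆⇒≼ : ∀ {x y} → x ⊆ₛ y → x ≼ y
    ⊆⇒≼ {x} {y} x⊆y = sym (proj₁ (⊆⇔≡∧ x y) x⊆y)

    ≼⇒⊆ : ∀ {x y} → x ≼ y → x ⊆ₛ y
    ≼⇒⊆ {x} {y} x≼y = proj₂ (⊆⇔≡∧ x y) (sym x≼y)

  ⊆-refl : ∀ {x} → x ⊆ₛ x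
  ⊆-refl = ≼⇒⊆ ≼-refl

  ⊆-trans : ∀ {x y z} → x ⊆ₛ y → y ⊆ₛ z → x ⊆ₛ z
  ⊆-trans x⊆y y⊆z = ≼⇒⊆ (≼-trans (⊆⇒≼ x⊆y) (⊆⇒≼ y⊆z))

  ⊆-antisym : ∀ {x y} → x ⊆ₛ y → y ⊆ₛ x → x ≡ y
  ⊆-antisym x⊆y y⊆x = ≼-antisym (⊆⇒≼ x⊆y) (⊆⇒≼ y⊆x)

  x∧y⊆x : ∀ x y → (x ∧ y) ⊆ₛ x
  x∧y⊆x x y = ≼⇒⊆ (proj₁ (IsLattice.infimum ∨-∧-isOrderTheoreticLattice x y))

  x∧y⊆y : ∀ x y → (x ∧ y) ⊆ₛ y
  x∧y⊆y x y = ≼⇒⊆ (proj₁ (proj₂ (IsLattice.infimum ∨-∧-isOrderTheoreticLattice x y)))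

  ⊆-∧ : ∀ {z x y} → z ⊆ₛ x → z ⊆ₛ y → z ⊆ₛ (x ∧ y)
  ⊆-∧ {z} {x} {y} z⊆x z⊆y =
    ≼⇒⊆ (proj₂ (proj₂ (IsLattice.infimum ∨-∧-isOrderTheoreticLattice x y)) z (⊆⇒≼ z⊆x) (⊆⇒≼ z⊆y))

  ⊆⊥⇒≡⊥ : ∀ {x} → x ⊆ₛ botₛ → x ≡ botₛ
  ⊆⊥⇒≡⊥ x⊆⊥ = ⊆-antisym x⊆⊥ (bot-least _)

  atom⊈⊥ : ∀ {a} → Atₛ a → ¬ (a ⊆ₛ botₛ)
  atom⊈⊥ {a} ata a⊆⊥ = proj₁ (proj₁ (At-atoms a) ata) (⊆⊥⇒≡⊥ a⊆⊥)

  atom⊆atom⇒≡ : ∀ {a b} → Atₛ a → Atₛ b → b ⊆ₛ a → b ≡ a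
  atom⊆atom⇒≡ {a} {b} ata atb b⊆a with proj₂ (proj₁ (At-atoms a) ata) b b⊆a
  ... | inj₁ b≡⊥ = ⊥-elim (atom⊈⊥ atb (subst (_⊆ₛ botₛ) (sym b≡⊥) ⊆-refl))
  ... | inj₂ b≡a = b≡a

  nonempty⇒atom : ∀ {X} → X ≢ botₛ → ∃[ a ] (Atₛ a × a ⊆ₛ X)
  nonempty⇒atom X≢⊥ =
    let (a , isAtom-a , a⊆X) = atomic _ X≢⊥ in a , proj₂ (At-atoms a) isAtom-a , a⊆X

  ⊆-by-atoms : ∀ {X Y} → (∀ a → Atₛ a → a ⊆ₛ X → a ⊆ₛ Y) → X ⊆ₛ Y
  ⊆-by-atoms {X} {Y} h with lem {X ∧ ∁ Y ≡ botₛ}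
  ... | yes X∧∁Y≡⊥ = ≼⇒⊆ (begin
    X                       ≡⟨ sym (∧-identityʳ X) ⟩
    X ∧ ⊤ᴮ                  ≡⟨ cong (X ∧_) (sym (∨-complementʳ Y)) ⟩
    X ∧ (Y ∨ ∁ Y)           ≡⟨ ∧-distribˡ-∨ X Y (∁ Y) ⟩
    (X ∧ Y) ∨ (X ∧ ∁ Y)     ≡⟨ cong ((X ∧ Y) ∨_) X∧∁Y≡⊥ ⟩
    (X ∧ Y) ∨ botₛ          ≡⟨ ∨-identityʳ (X ∧ Y) ⟩
    X ∧ Y                   ∎)
    where open ≡-Reasoning
  ... | no X∧∁Y≢⊥ =
    let (a , ata , a⊆) = nonempty⇒atom X∧∁Y≢⊥
        a⊆Y∧∁Y = ⊆-∧ (h a ata (⊆-trans a⊆ (x∧y⊆x X (∁ Y)))) (⊆-trans a⊆ (x∧y⊆y X (∁ Y)))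
    in ⊥-elim (atom⊈⊥ ata (subst (a ⊆ₛ_) (∧-complementʳ Y) a⊆Y∧∁Y))

  ≡-by-atoms : ∀ {X Y} → (∀ a → Atₛ a → a ⊆ₛ X ⇔ a ⊆ₛ Y) → X ≡ Y
  ≡-by-atoms h = ⊆-antisym (⊆-by-atoms λ a ata → proj₁ (h a ata))
                           (⊆-by-atoms λ a ata → proj₂ (h a ata))

  atomless⇒≡⊥ : ∀ {X} → (∀ a → Atₛ a → ¬ (a ⊆ₛ X)) → X ≡ botₛ
  atomless⇒≡⊥ h = ⊆-antisym (⊆-by-atoms λ a ata a⊆X → ⊥-elim (h a ata a⊆X)) (bot-least _)

  restrict : Carrier → Restricted
  restrict I = M ↾ (_⊆ₛ I)

  insert : Carrier → Carrier → Carrier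
  insert x X = proj₁ (comprehension 2 insertFormula (extend M X (extend M x (noVars M))))
    where
    insertFormula : Formula 3
    insertFormula = (var zero ⊆' var (suc zero)) ∨' (var zero ≐ var (suc (suc zero)))

  ⊆insert⇔ : ∀ {x X a} → Atₛ a → a ⊆ₛ insert x X ⇔ (a ⊆ₛ X ⊎ a ≡ x)
  ⊆insert⇔ {x} {X} {a} = proj₂ (comprehension 2 _ (extend M X (extend M x (noVars M)))) a

  IsSegment IsStrictSegment : Carrier → Carrier → Set
  IsSegment       I x = ∀ y → Atₛ y → y ⊆ₛ I ⇔ (y ⊲ₛ x ⊎ y ≡ x)
  IsStrictSegment J x = ∀ y → Atₛ y → y ⊆ₛ J ⇔ y ⊲ₛ x

  insert-segment : ∀ {J x} → IsStrictSegment J x → IsSegment (insert x J) x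
  insert-segment J↓x y aty = ⇔-trans (⊆insert⇔ aty) (⊎-⇔ (J↓x y aty) ⇔-refl)

  module SegmentExtension {J x : Carrier} (atx : Atₛ x) (J↓x : IsStrictSegment J x) where

    join : Carrier → Bool → Carrier
    join X false = X
    join X true  = insert x X

    x⊈ : ∀ {X} → X ⊆ₛ J → ¬ (x ⊆ₛ X)
    x⊈ X⊆J x⊆X = ⊲-irrefl x atx (proj₁ (J↓x x atx) (⊆-trans x⊆X X⊆J))

    ⊆join⇔ : ∀ X e {a} → Atₛ a → a ⊆ₛ join X e ⇔ (a ⊆ₛ X ⊎ (a ≡ x × e ≡ true))
    ⊆join⇔ X false ata = inj₁ , λ { (inj₁ a⊆X) → a⊆X ; (inj₂ (_ , ())) }
    ⊆join⇔ X true  ata = ⇔-trans (⊆insert⇔ ata) (⊎-⇔ ⇔-refl ((_, refl) , proj₁))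

    X⊆join : ∀ X e → X ⊆ₛ join X e
    X⊆join X e = ⊆-by-atoms λ a ata a⊆X → proj₂ (⊆join⇔ X e ata) (inj₁ a⊆X)

    x⊆join⇔ : ∀ {X} e → X ⊆ₛ J → x ⊆ₛ join X e ⇔ (e ≡ true)
    x⊆join⇔ {X} e X⊆J =
      (λ x⊆ → [ (λ x⊆X → ⊥-elim (x⊈ X⊆J x⊆X)) , proj₂ ]′ (proj₁ (⊆join⇔ X e atx) x⊆)) ,
      (λ e≡ → proj₂ (⊆join⇔ X e atx) (inj₂ (refl , e≡)))

    ⊆join-old : ∀ {X Y a} f → X ⊆ₛ J → Atₛ a → a ⊆ₛ X → a ⊆ₛ join Y f → a ⊆ₛ Y
    ⊆join-old {Y = Y} f X⊆J ata a⊆X a⊆join with proj₁ (⊆join⇔ Y f ata) a⊆join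
    ... | inj₁ a⊆Y       = a⊆Y
    ... | inj₂ (refl , _) = ⊥-elim (x⊈ X⊆J a⊆X)

    join-dom : ∀ {X} e → X ⊆ₛ J → join X e ⊆ₛ insert x J
    join-dom {X} e X⊆J = ⊆-by-atoms λ a ata a⊆ → proj₂ (⊆insert⇔ ata)
      (Data.Sum.map (λ a⊆X → ⊆-trans a⊆X X⊆J) proj₁ (proj₁ (⊆join⇔ X e ata) a⊆))

    split : ∀ Y → Y ⊆ₛ insert x J → ∃[ X ] ∃[ e ] (X ⊆ₛ J × Y ≡ join X e)
    split Y Y⊆ with lem {x ⊆ₛ Y}
    ... | yes x⊆Y = (Y ∧ J) , true , x∧y⊆y Y J , ≡-by-atoms λ a ata →
      (λ a⊆Y → proj₂ (⊆insert⇔ ata)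
                 (Data.Sum.map₁ (⊆-∧ a⊆Y) (proj₁ (⊆insert⇔ ata) (⊆-trans a⊆Y Y⊆)))) ,
      (λ a⊆ → [ (λ a⊆Y∧J → ⊆-trans a⊆Y∧J (x∧y⊆x Y J)) , (λ { refl → x⊆Y }) ]′ (proj₁ (⊆insert⇔ ata) a⊆))
    ... | no x⊈Y = (Y ∧ J) , false , x∧y⊆y Y J , ≡-by-atoms λ a ata →
      (λ a⊆Y → [ ⊆-∧ a⊆Y , (λ { refl → ⊥-elim (x⊈Y a⊆Y) }) ]′ (proj₁ (⊆insert⇔ ata) (⊆-trans a⊆Y Y⊆))) ,
      (λ a⊆Y∧J → ⊆-trans a⊆Y∧J (x∧y⊆x Y J))

    join-⊆ : ∀ {X Y} e f → X ⊆ₛ J → Y ⊆ₛ J → (join X e ⊆ₛ join Y f) ⇔ (X ⊆ₛ Y × (e ≡ true → f ≡ true))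
    join-⊆ {X} {Y} e f X⊆J Y⊆J = to , from
      where
      to : join X e ⊆ₛ join Y f → X ⊆ₛ Y × (e ≡ true → f ≡ true)
      to X′⊆Y′ = ⊆-by-atoms (λ a ata a⊆X → ⊆join-old f X⊆J ata a⊆X (⊆-trans a⊆X (⊆-trans (X⊆join X e) X′⊆Y′))) ,
                 (λ e≡ → proj₁ (x⊆join⇔ f Y⊆J) (⊆-trans (proj₂ (x⊆join⇔ e X⊆J) e≡) X′⊆Y′))
      from : X ⊆ₛ Y × (e ≡ true → f ≡ true) → join X e ⊆ₛ join Y f
      from (X⊆Y , e⇒f) = ⊆-by-atoms λ a ata a⊆ → [
        (λ a⊆X → ⊆-trans (⊆-trans a⊆X X⊆Y) (X⊆join Y f)) ,
        (λ { (refl , e≡) → proj₂ (x⊆join⇔ f Y⊆J) (e⇒f e≡) }) ]′ (proj₁ (⊆join⇔ X e ata) a⊆)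

    join-≡ : ∀ {X Y} e f → X ⊆ₛ J → Y ⊆ₛ J → (join X e ≡ join Y f) ⇔ (X ≡ Y × e ≡ f)
    join-≡ {X} {Y} e f X⊆J Y⊆J = to , λ { (refl , refl) → refl }
      where
      to : join X e ≡ join Y f → X ≡ Y × e ≡ f
      to X′≡Y′ =
        let (X⊆Y , e⇒f) = proj₁ (join-⊆ e f X⊆J Y⊆J) (subst (join X e ⊆ₛ_) X′≡Y′ ⊆-refl)
            (Y⊆X , f⇒e) = proj₁ (join-⊆ f e Y⊆J X⊆J) (subst (_⊆ₛ join X e) X′≡Y′ ⊆-refl)
        in ⊆-antisym X⊆Y Y⊆X , true⇔true⇒≡ e⇒f f⇒e

    join-≡⊥ : ∀ {X} e → X ⊆ₛ J → (join X e ≡ botₛ) ⇔ (X ≡ botₛ × e ≡ false)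
    join-≡⊥ false X⊆J = (_, refl) , proj₁
    join-≡⊥ true  X⊆J =
      (λ X′≡⊥ → ⊥-elim (atom⊈⊥ atx (subst (x ⊆ₛ_) X′≡⊥ (proj₂ (x⊆join⇔ true X⊆J) refl)))) , λ { (_ , ()) }

    insert-⊥ : insert x botₛ ≡ x
    insert-⊥ = ≡-by-atoms λ a ata →
      (λ a⊆ → [ ⊥-elim ∘ atom⊈⊥ ata , (λ { refl → ⊆-refl }) ]′ (proj₁ (⊆insert⇔ ata) a⊆)) ,
      (λ a⊆x → proj₂ (⊆insert⇔ ata) (inj₂ (atom⊆atom⇒≡ atx ata a⊆x)))

    join-At : ∀ {X} e → X ⊆ₛ J → Atₛ (join X e) ⇔ ((Atₛ X × e ≡ false) ⊎ (X ≡ botₛ × e ≡ true))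
    join-At false X⊆J = inj₁ ∘ (_, refl) , [ proj₁ , (λ { (_ , ()) }) ]′
    join-At {X} true X⊆J = to , λ { (inj₁ (_ , ())) ; (inj₂ (refl , _)) → subst Atₛ (sym insert-⊥) atx }
      where
      -- insert x X is an atom containing x, so every atom of X would be x, which is not in X.
      to : Atₛ (insert x X) → (Atₛ X × true ≡ false) ⊎ (X ≡ botₛ × true ≡ true)
      to atX′ = inj₂ (atomless⇒≡⊥ (λ b atb b⊆X → x⊈ X⊆J (subst (_⊆ₛ X) (b≡x atb b⊆X) b⊆X)) , refl)
        where
        b≡x : ∀ {b} → Atₛ b → b ⊆ₛ X → b ≡ x
        b≡x atb b⊆X = trans (atom⊆atom⇒≡ atX′ atb (⊆-trans b⊆X (X⊆join X true)))
                            (sym (atom⊆atom⇒≡ atX′ atx (proj₂ (x⊆join⇔ true X⊆J) refl)))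

    join-⊲ : ∀ {X Y} e f → X ⊆ₛ J → Y ⊆ₛ J → (join X e ⊲ₛ join Y f) ⇔ (X ⊲ₛ Y ⊎ (X ≢ botₛ × f ≡ true))
    join-⊲ {X} {Y} e f X⊆J Y⊆J = to , from
      where
      to : join X e ⊲ₛ join Y f → X ⊲ₛ Y ⊎ (X ≢ botₛ × f ≡ true)
      to X′⊲Y′ with proj₁ (⊲-ext _ _) X′⊲Y′
      ... | z , w , atz , atw , z⊆ , w⊆ , z⊲w with proj₁ (⊆join⇔ X e atz) z⊆ | proj₁ (⊆join⇔ Y f atw) w⊆
      ... | inj₁ z⊆X        | inj₁ w⊆Y         = inj₁ (proj₂ (⊲-ext X Y) (z , w , atz , atw , z⊆X , w⊆Y , z⊲w))
      ... | inj₁ z⊆X        | inj₂ (refl , f≡) = inj₂ ((λ X≡⊥ → atom⊈⊥ atz (subst (z ⊆ₛ_) X≡⊥ z⊆X)) , f≡)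
      ... | inj₂ (refl , _) | inj₁ w⊆Y         =
        ⊥-elim (⊲-irrefl x atx (⊲-trans x w x atx atw atx z⊲w (proj₁ (J↓x w atw) (⊆-trans w⊆Y Y⊆J))))
      ... | inj₂ (refl , _) | inj₂ (refl , _)  = ⊥-elim (⊲-irrefl x atx z⊲w)
      from : X ⊲ₛ Y ⊎ (X ≢ botₛ × f ≡ true) → join X e ⊲ₛ join Y f
      from (inj₁ X⊲Y) =
        let (z , w , atz , atw , z⊆X , w⊆Y , z⊲w) = proj₁ (⊲-ext X Y) X⊲Y
        in proj₂ (⊲-ext _ _) (z , w , atz , atw , ⊆-trans z⊆X (X⊆join X e) , ⊆-trans w⊆Y (X⊆join Y f) , z⊲w)
      from (inj₂ (X≢⊥ , refl)) =
        let (z , atz , z⊆X) = nonempty⇒atom X≢⊥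
        in proj₂ (⊲-ext _ _) (z , x , atz , atx , ⊆-trans z⊆X (X⊆join X e) , proj₂ (x⊆join⇔ true Y⊆J) refl ,
                              proj₁ (J↓x z atz) (⊆-trans z⊆X X⊆J))

    segment-extension : Extension (restrict J) (restrict (insert x J))
    segment-extension = record
      { join = join ; join-dom = join-dom ; split = split
      ; join-≡ = join-≡ ; join-≡⊥ = join-≡⊥ ; join-At = join-At ; join-⊆ = join-⊆ ; join-⊲ = join-⊲ }

  open Game

  Agree-⊥ : ∀ {m} (ρ : Env M m) (σ : Env (MSO 0) m) → (∀ i → ρ i ⊆ₛ botₛ) →
            Agree (restrict botₛ) (total (MSO 0)) ρ σ
  Agree-⊥ ρ σ ρ⊆⊥ (eqᵃ i j)  =
    ⇔-both (trans (⊆⊥⇒≡⊥ (ρ⊆⊥ i)) (sym (⊆⊥⇒≡⊥ (ρ⊆⊥ j)))) (trans (Subset₀ (σ i)) (sym (Subset₀ (σ j))))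
  Agree-⊥ ρ σ ρ⊆⊥ (subᵃ i j) = ⇔-both (subst (_⊆ₛ ρ j) (sym (⊆⊥⇒≡⊥ (ρ⊆⊥ i))) (bot-least _)) λ { {()} }
  Agree-⊥ ρ σ ρ⊆⊥ (ltᵃ i j)  =
    ⇔-neither (λ ρi⊲ρj → let (z , _ , atz , _ , z⊆ρi , _) = proj₁ (⊲-ext _ _) ρi⊲ρj
                         in atom⊈⊥ atz (⊆-trans z⊆ρi (ρ⊆⊥ i)))
              λ { (() , _) }
  Agree-⊥ ρ σ ρ⊆⊥ (botᵃ i)   = ⇔-both (⊆⊥⇒≡⊥ (ρ⊆⊥ i)) (Subset₀ (σ i))
  Agree-⊥ ρ σ ρ⊆⊥ (atᵃ i)    = ⇔-neither (λ atρi → atom⊈⊥ atρi (ρ⊆⊥ i)) λ { (() , _) }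

  IIWins-⊥ : ∀ k {m} (ρ : Env M m) (σ : Env (MSO 0) m) → (∀ i → ρ i ⊆ₛ botₛ) →
             IIWins (restrict botₛ) (total (MSO 0)) k ρ σ
  IIWins-⊥ zero    ρ σ ρ⊆⊥ = Agree-⊥ ρ σ ρ⊆⊥
  IIWins-⊥ (suc k) ρ σ ρ⊆⊥ =
    Agree-⊥ ρ σ ρ⊆⊥ ,
    (λ a a⊆⊥ → [] , tt ,
       IIWins-⊥ k (extend M a ρ) (extend (MSO 0) [] σ) (extend-dom {D = _⊆ₛ botₛ} a⊆⊥ ρ⊆⊥)) ,
    (λ b _ → botₛ , ⊆-refl ,
       IIWins-⊥ k (extend M botₛ ρ) (extend (MSO 0) b σ) (extend-dom {D = _⊆ₛ botₛ} ⊆-refl ρ⊆⊥))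

  ⊲-induction : (P : Carrier → Set) → (∃[ F ] ∀ y → Atₛ y → y ⊆ₛ F ⇔ (¬ P y)) →
                (∀ x → Atₛ x → (∀ y → Atₛ y → y ⊲ₛ x → P y) → P x) → ∀ x → Atₛ x → P x
  ⊲-induction P (F , ⊆F⇔) step x atx with lem {P x}
  ... | yes px  = px
  ... | no  ¬px with least F (λ F≡⊥ → atom⊈⊥ atx (subst (x ⊆ₛ_) F≡⊥ (proj₂ (⊆F⇔ x atx) ¬px)))
  ...   | x₀ , atx₀ , x₀⊆F , x₀-least = ⊥-elim (proj₁ (⊆F⇔ x₀ atx₀) x₀⊆F (step x₀ atx₀ below-x₀))
    where
    below-x₀ : ∀ y → Atₛ y → y ⊲ₛ x₀ → P y
    below-x₀ y aty y⊲x₀ with lem {P y}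
    ... | yes py  = py
    ... | no  ¬py with x₀-least y aty (proj₂ (⊆F⇔ y aty) ¬py)
    ...   | inj₁ refl  = ⊥-elim (⊲-irrefl y aty y⊲x₀)
    ...   | inj₂ x₀⊲y = ⊥-elim (⊲-irrefl y aty (⊲-trans y x₀ y aty atx₀ aty y⊲x₀ x₀⊲y))

  predecessor-segment : ∀ {I p x} → Atₛ p → Atₛ x → IsSegment I p → p ⊲ₛ x →
                        (∀ y → Atₛ y → y ⊲ₛ x → ¬ (p ⊲ₛ y)) → IsStrictSegment I x
  predecessor-segment {I} {p} {x} atp atx I↓p p⊲x p-immediate y aty = ⇔-trans (I↓p y aty) (to , from)
    where
    to : y ⊲ₛ p ⊎ y ≡ p → y ⊲ₛ x
    to (inj₁ y⊲p) = ⊲-trans y p x aty atp atx y⊲p p⊲x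
    to (inj₂ refl) = p⊲x
    from : y ⊲ₛ x → y ⊲ₛ p ⊎ y ≡ p
    from y⊲x with ⊲-total y p aty atp
    ... | inj₁ y⊲p         = inj₁ y⊲p
    ... | inj₂ (inj₁ y≡p)  = inj₂ y≡p
    ... | inj₂ (inj₂ p⊲y)  = ⊥-elim (p-immediate y aty y⊲x p⊲y)

-- Induction along the atoms

module Induction (lem : ExcludedMiddle 0ℓ) (k : ℕ) (M : Structure) (TM : ModelsTMSOFin M) where
  open Structure M
  open ModelsTMSOFin TM
  open ModelsTbase base
  open Model lem M TM
  open Game

  Good : Carrier → Set
  Good I = ∃[ n ] IIWins (restrict I) (total (MSO n)) k (noVars M) (noVars (MSO n))

  Good-⊥ : Good botₛ
  Good-⊥ = 0 , IIWins-⊥ k (noVars M) (noVars (MSO 0)) (λ ())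

  Good-insert : ∀ {J x} → Atₛ x → IsStrictSegment J x → Good J → Good (insert x J)
  Good-insert atx J↓x (n , g) =
    suc n , IIWins-cong _ _ k (λ ()) (λ ())
      (IIWins-extend (SegmentExtension.segment-extension atx J↓x) (MSO-extension n) k (λ ()) (λ ()) (λ ()) g)

  RealisedInMSO : List (Formula 0) → Set
  RealisedInMSO τ = ∃[ n ] All (Sat↾ (total (MSO n)) (noVars (MSO n))) τ

  realisedTypes : List (List (Formula 0))
  realisedTypes = filter (λ τ → lem {RealisedInMSO τ}) (types k 0)

  segmentFormula : Formula 2
  segmentFormula = ∀' (At' y ⇒' (((y ⊆' I) ⇒' y⊴x) ∧' (y⊴x ⇒' (y ⊆' I))))
    where
    y I x : Term 3
    y = var zero
    I = var (suc zero)
    x = var (suc (suc zero))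
    y⊴x : Formula 3
    y⊴x = (y ⊲' x) ∨' (y ≐ x)

  relativisedType : List (Formula 0) → Formula 2
  relativisedType τ = ⋀ (map (relativise (λ ()) zero) τ)

  goodSegmentFormula : Formula 1
  goodSegmentFormula = ∃' (segmentFormula ∧' ⋁ (map relativisedType realisedTypes))

  HasGoodSegment : Carrier → Set
  HasGoodSegment x = Sat M (extend M x (noVars M)) goodSegmentFormula

  Sat-relativisedType : ∀ I x τ → Sat M (extend M I (extend M x (noVars M))) (relativisedType τ) ⇔
                                  All (Sat↾ (restrict I) (noVars M)) τ
  Sat-relativisedType I x τ =
    ⇔-trans (Sat-⋀ M _) (⇔-trans (All.map⁻ , All.map⁺) (All-⇔ (Sat-relativise M (λ ()) zero (λ ()))))

  HasGoodSegment⇔ : ∀ x → HasGoodSegment x ⇔ ∃[ I ] (IsSegment I x × Good I)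
  HasGoodSegment⇔ x = to , from
    where
    to : HasGoodSegment x → ∃[ I ] (IsSegment I x × Good I)
    to (I , I↓x , sat) =
      let (τ , τ∈ , satτ)  = find (Any.map⁻ (proj₁ (Sat-⋁ M _) sat))
          (τ∈types , n , satMSO) = ∈-filter⁻ (λ τ → lem {RealisedInMSO τ}) τ∈
      in I , I↓x , n , sameType⇒IIWins lem (restrict I) (total (MSO n)) k τ∈types
                         (proj₁ (Sat-relativisedType I x τ) satτ) satMSO
    from : ∃[ I ] (IsSegment I x × Good I) → HasGoodSegment x
    from (I , I↓x , n , g) =
      let (τ , τ∈types , satI) = type-realised lem k 0 (restrict I) (noVars M)
          satMSO = All.zipWith (λ ((u , q) , s) → proj₁ (IIWins-sound (restrict I) (total (MSO n)) k g u q) s)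
                               (types-unnested k 0 τ∈types , satI)
          τ∈ = ∈-filter⁺ (λ τ → lem {RealisedInMSO τ}) τ∈types (n , satMSO)
      in I , I↓x , proj₂ (Sat-⋁ M _) (Any.map⁺ (lose τ∈ (proj₂ (Sat-relativisedType I x τ) satI)))

  strict-segment : ∀ x → Atₛ x → (∀ y → Atₛ y → y ⊲ₛ x → HasGoodSegment y) →
                   ∃[ J ] (IsStrictSegment J x × Good J)
  strict-segment x atx ih with lem {∃[ y ] (Atₛ y × y ⊲ₛ x)}
  ... | no ¬∃y⊲x = botₛ , (λ y aty → ⇔-neither (atom⊈⊥ aty) (λ y⊲x → ¬∃y⊲x (y , aty , y⊲x))) , Good-⊥
  ... | yes ∃y⊲x with pred x atx ∃y⊲x
  ...   | p , atp , p⊲x , p-immediate with proj₁ (HasGoodSegment⇔ p) (ih p atp p⊲x)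
  ...     | I , I↓p , goodI = I , predecessor-segment atp atx I↓p p⊲x p-immediate , goodI

  every-atom-has-good-segment : ∀ x → Atₛ x → HasGoodSegment x
  every-atom-has-good-segment =
    ⊲-induction HasGoodSegment (comprehension 0 (¬' goodSegmentFormula) (noVars M)) step
    where
    step : ∀ x → Atₛ x → (∀ y → Atₛ y → y ⊲ₛ x → HasGoodSegment y) → HasGoodSegment x
    step x atx ih =
      let (J , J↓x , goodJ) = strict-segment x atx ih
      in proj₂ (HasGoodSegment⇔ x) (insert x J , insert-segment J↓x , Good-insert atx J↓x goodJ)

  whole-model : ∃[ I ] ((∀ X → X ⊆ₛ I) × Good I)
  whole-model with lem {∃[ a ] Atₛ a}
  ... | no ¬∃atom = botₛ , (λ X → ⊆-by-atoms λ a ata _ → ⊥-elim (¬∃atom (a , ata))) , Good-⊥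
  ... | yes ∃atom with proj₂ (endpoints ∃atom)
  ...   | l , atl , l-greatest with proj₁ (HasGoodSegment⇔ l) (every-atom-has-good-segment l atl)
  ...     | I , I↓l , goodI = I , (λ X → ⊆-by-atoms λ a ata _ → proj₂ (I↓l a ata) (swap (l-greatest a ata))) , goodI

proposition3p10 : ExcludedMiddle 0ℓ →
    (k : ℕ) (M : Structure) → ModelsTMSOFin M → ∃[ n ] (M ≈[ k ] MSO n)
proposition3p10 lem k M TM =
  let (I , I-top , n , g) = Induction.whole-model lem k M TM
  in n , λ φ u q → through (Sat⇔Sat↾ M I-top (noVars M) φ)
                           (Game.IIWins-sound (Model.restrict lem M TM I) (total (MSO n)) k g u q)
                           (Sat⇔Sat↾ (MSO n) (λ _ → tt) (noVars (MSO n)) φ)
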